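{- Let $M=(ST,AC,\{av_A\}_{A\subseteq AG},\{out_A\}_{A\subseteq AG},lab)$ be an abstract multi-agent action model. The following three conditions are equivalent. (1) For every $a\in AG$, $A\subseteq AG$ and $s\in ST$: (a) $av_a(s)\neq\emptyset$; (b) $av_A(s)=\bigoplus\{av_a(s):a\in A\}$. (2) For all $A,B\subseteq AG$ with $A\cap B=\emptyset$ and all $s\in ST$: (a) $av_A(s)\neq\emptyset$; (b) for every $\sigma_{A\cup B}\in av_{A\cup B}(s)$, $\sigma_{A\cup B}|_A\in av_A(s)$; (c) for every $\sigma_A\in av_A(s)$ and $\sigma_B\in av_B(s)$, $\sigma_A\cup\sigma_B\in av_{A\cup B}(s)$. (3) For every $A\subseteq AG$ and $s\in ST$: (a) $av_A(s)\neq\emptyset$; (b) for every $\sigma_{AG}\in av_{AG}(s)$, $\sigma_{AG}|_A\in av_A(s)$; (c) for every $\sigma_A\in av_A(s)$ and $\sigma_{\overline A}\in av_{\overline A}(s)$, $\sigma_A\cup\sigma_{\overline A}\in av_{AG}(s)$, where $\overline A=AG\setminus A$.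
   Context: Fix a nonempty finite set $AG$ of agents and a countable set $AP$ of atomic propositions; a coalition is any $A\subseteq AG$; write $a$ for $\{a\}$. Given a nonempty set $AC$ of actions, a joint action of $A$ is a function $\sigma_A:A\to AC$; $JA_A$ is the set of them ($JA_\emptyset=\{\emptyset\}$); joint actions are sets of ordered pairs, so unions apply; for $B\subseteq A$, $\sigma_A|_B$ is the restriction of $\sigma_A$ to $B$. For a family $\{A_i\}_{i\in I}$ of pairwise disjoint coalitions and $\Lambda=\{\Sigma_{A_i}:i\in I\}$ with each $\Sigma_{A_i}\subseteq JA_{A_i}$, $\bigoplus\Lambda$ is the set of all $\bigcup_{i\in I}f(i)$ where $f$ ranges over functions with $f(i)\in\Sigma_{A_i}$ for each $i$; in particular $\bigoplus\emptyset=\{\emptyset\}$ (here $\{av_a(s):a\in A\}$ is indexed by $a\in A$ with $A_a=\{a\}$). An abstract multi-agent action model is $M=(ST,AC,\{av_A\},\{out_A\},lab)$ with $ST$ a nonempty set of states, $AC$ a nonempty set of actions, $av_A:ST\to\mathcal P(JA_A)$, $out_A:ST\times JA_A\to\mathcal P(ST)$, $lab:ST\to\mathcal P(AP)$. -}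

module Defs where

open import Data.Nat using (ℕ; suc)
open import Data.Fin using (Fin)
open import Data.Fin.Subset using (Subset; _∈_; ⁅_⁆; ⊤; ⊥; ∁; _∪_; _∩_)
open import Data.Fin.Subset.Properties using (_∈?_)
open import Data.Bool using (Bool; true; false; if_then_else_)
open import Data.Maybe using (Maybe; just; nothing; is-just)
open import Data.Vec using (Vec; map; zipWith; tabulate)
open import Data.Product using (Σ; ∃; _×_; _,_)
open import Relation.Nullary using (yes; no)
open import Relation.Binary.PropositionalEquality using (_≡_)
open import Function.Definitions using (Injective)

-- Agents AG = Fin n (n = suc k, so AG is nonempty and finite).
-- A (partial) joint action is a finite set of ordered pairs (agent, action)
-- which is functional: represented as a vector of optional actions.
PJA : ℕ → Set → Set
PJA n AC = Vec (Maybe AC) n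

dom : ∀ {n AC} → PJA n AC → Subset n
dom σ = map is-just σ

IsJA : ∀ {n AC} → Subset n → PJA n AC → Set
IsJA A σ = dom σ ≡ A

restrict : ∀ {n AC} → PJA n AC → Subset n → PJA n AC
restrict σ B = zipWith (λ b x → if b then x else nothing) B σ

-- union of two joint actions (as sets of ordered pairs; for disjoint
-- domains this is exactly the set-theoretic union)
_∪J_ : ∀ {n AC} → PJA n AC → PJA n AC → PJA n AC
σ ∪J τ = zipWith pick σ τ
  where
  pick : ∀ {X : Set} → Maybe X → Maybe X → Maybe X
  pick (just x) _ = just x
  pick nothing  y = y

-- ⋃_{a ∈ A} f(a) for a family f indexed by the agents a ∈ A, where each
-- f(a) is a joint action of the singleton coalition {a}
bigUnion : ∀ {n AC} (A : Subset n) → ((a : Fin n) → a ∈ A → PJA n AC) → PJA n AC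
bigUnion {n} {AC} A f = tabulate g
  where
  g : Fin n → Maybe AC
  g i with i ∈? A
  ... | yes p = Data.Vec.lookup (f i p) i
  ... | no _  = nothing

-- Abstract multi-agent action model over agents Fin n and atomic props AP.
-- Subsets P(X) are represented as predicates X → Set.
record Model (n : ℕ) (AP : Set) : Set₁ where
  field
    ST     : Set
    st₀    : ST
    AC     : Set
    ac₀    : AC
    av     : Subset n → ST → PJA n AC → Set
    av-JA  : ∀ A s σ → av A s σ → IsJA A σ
    out    : Subset n → ST → PJA n AC → ST → Set
    out-JA : ∀ A s σ t → out A s σ t → IsJA A σ
    lab    : ST → AP → Set

⊕av : ∀ {n AP} (M : Model n AP) → Subset n → Model.ST M → PJA n (Model.AC M) → Set
⊕av {n} M A s σ =
  Σ ((a : Fin n) → a ∈ A → PJA n (Model.AC M)) λ f →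
    ((a : Fin n) (p : a ∈ A) → Model.av M ⁅ a ⁆ s (f a p)) × (σ ≡ bigUnion A f)

Countable : Set → Set
Countable X = Σ (X → ℕ) (Injective _≡_ _≡_)

module _ {n AP} (M : Model n AP) where
  open Model M

  Cond1 : Set
  Cond1 = ∀ (a : Fin n) (A : Subset n) (s : ST) →
            (∃ λ σ → av ⁅ a ⁆ s σ)
          × (∀ σ → (av A s σ → ⊕av M A s σ) × (⊕av M A s σ → av A s σ))

  Cond2 : Set
  Cond2 = ∀ (A B : Subset n) → A ∩ B ≡ ⊥ → (s : ST) →
            (∃ λ σ → av A s σ)
          × (∀ σ → av (A ∪ B) s σ → av A s (restrict σ A))
          × (∀ σA σB → av A s σA → av B s σB → av (A ∪ B) s (σA ∪J σB))

  Cond3 : Set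
  Cond3 = ∀ (A : Subset n) (s : ST) →
            (∃ λ σ → av A s σ)
          × (∀ σ → av ⊤ s σ → av A s (restrict σ A))
          × (∀ σA σA' → av A s σA → av (∁ A) s σA' → av ⊤ s (σA ∪J σA'))

{-# OPTIONS --safe #-}
-- Call σ agentwise available for A at s when dom σ = A and every one-agent restriction σ|a lies in
-- av_a(s); unfolding ⊕, this is exactly σ ∈ ⊕{av_a(s) : a ∈ A}. So (1) says that av_A(s) is the set of
-- agentwise available joint actions, and that set is closed under restriction and under ∪J, which is (2). Conversely, under (2) a member of av_A(s) is agentwise available by
-- splitting A = {a} ∪ (A - a), and an agentwise available σ lies in av_A(s) by well-founded induction on
-- A: add one agent at a time with (2c), starting from av_∅(s) = {∅}. (3) is (2) for B = Ā. Under (3) every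
-- σ ∈ av_C(s) is the restriction of a full τ ∈ av_AG(s) (glue on any element of av_C̄(s)); then (2b)
-- follows from (3b), and (2c) by gluing σ_A to τ|Ā, where τ extends σ_B, and restricting the result
-- to A ∪ B.
module Submission where

open import Defs
open import Data.Nat using (ℕ; suc)
open import Data.Product using (_×_)
open import Function.Bundles using (_⇔_)

open import Data.Bool using (true; false)
open import Data.Empty using (⊥-elim)
open import Data.Fin using (Fin; zero; suc)
open import Data.Fin.Subset using (Subset; _∈_; _∉_; _⊆_; _⊂_; _─_; _-_; ⁅_⁆; ⊤; ⊥; ∁; _∪_; _∩_)
open import Data.Fin.Subset.Properties
  using (_∈?_; nonempty?; Empty-unique; x∈⁅x⁆; x∈⁅y⁆⇒x≡y; ⊆-antisym; p∩q⊆q; x∈p∩q⁺; p⊆p∪q; x∈p∪q⁺; x∈p∪q⁻;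
         p─q⊆p; x∈p∧x∉q⇒x∈p─q; x∈p⇒p-x⊂p; ∩-comm; ∩-zeroʳ; ∩-identityʳ; ∩-inverseʳ; ∩-abs-∪;
         ∩-distribˡ-∪; ∩-distribʳ-∪; ∪-inverseʳ)
open import Data.Fin.Subset.Induction using (⊂-wellFounded)
open import Induction.WellFounded using (Acc; acc)
open import Data.Maybe using (just; nothing; is-just)
open import Data.Vec using ([]; _∷_; lookup; replicate; here; there)
open import Data.Vec.Properties using (lookup∘tabulate; lookup-map; []=⇒lookup)
open import Data.Vec.Properties.WithK using ([]=-irrelevant)
open import Data.Vec.Relation.Binary.Pointwise.Extensional using (ext; Pointwise-≡⇒≡)
open import Data.Product using (∃; _,_; proj₁; proj₂)
open import Data.Sum using (inj₁; inj₂)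
open import Function.Base using (_∘_; _∋_)
open import Function.Bundles using (mk⇔; Equivalence)
open import Function.Construct.Composition using (_⇔-∘_)
open import Function.Construct.Symmetry using (⇔-sym)
open import Relation.Nullary using (yes; no)
open import Relation.Binary.PropositionalEquality
  using (_≡_; refl; sym; trans; cong; cong₂; subst; module ≡-Reasoning)

private
  variable
    n : ℕ
    Act : Set
    A B C D : Subset n
    i : Fin n

p⊆q⇒q∩p≡p : A ⊆ B → B ∩ A ≡ A
p⊆q⇒q∩p≡p {A = A} {B} A⊆B = ⊆-antisym (p∩q⊆q B A) (λ x∈A → x∈p∩q⁺ (A⊆B x∈A , x∈A))

p∩[q─p]≡⊥ : (A B : Subset n) → A ∩ (B ─ A) ≡ ⊥
p∩[q─p]≡⊥ []          []      = refl
p∩[q─p]≡⊥ (true ∷ A)  (_ ∷ B) = cong (false ∷_) (p∩[q─p]≡⊥ A B)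
p∩[q─p]≡⊥ (false ∷ A) (_ ∷ B) = cong (false ∷_) (p∩[q─p]≡⊥ A B)

p⊆q⇒p∪[q─p]≡q : A ⊆ B → A ∪ (B ─ A) ≡ B
p⊆q⇒p∪[q─p]≡q {A = A} {B} A⊆B = ⊆-antisym ∪⊆B B⊆∪
  where
  ∪⊆B : A ∪ (B ─ A) ⊆ B
  ∪⊆B x∈∪ with x∈p∪q⁻ A (B ─ A) x∈∪
  ... | inj₁ x∈A   = A⊆B x∈A
  ... | inj₂ x∈B─A = p─q⊆p B A x∈B─A
  B⊆∪ : B ⊆ A ∪ (B ─ A)
  B⊆∪ {x} x∈B with x ∈? A
  ... | yes x∈A = x∈p∪q⁺ (inj₁ x∈A)
  ... | no  x∉A = x∈p∪q⁺ (inj₂ (x∈p∧x∉q⇒x∈p─q x∈B x∉A))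

x∈p⇒⁅x⁆⊆p : i ∈ A → ⁅ i ⁆ ⊆ A
x∈p⇒⁅x⁆⊆p {A = A} i∈A y∈⁅i⁆ = subst (_∈ A) (sym (x∈⁅y⁆⇒x≡y _ y∈⁅i⁆)) i∈A

p∩q≡⊥⇒[p∪q]∩∁p≡q : A ∩ B ≡ ⊥ → (A ∪ B) ∩ ∁ A ≡ B
p∩q≡⊥⇒[p∪q]∩∁p≡q {A = A} {B} A∩B≡⊥ = begin
  (A ∪ B) ∩ ∁ A              ≡⟨ ∩-distribʳ-∪ (∁ A) A B ⟩
  A ∩ ∁ A ∪ B ∩ ∁ A          ≡⟨ cong (_∪ B ∩ ∁ A) (∩-inverseʳ A) ⟩
  ⊥ ∪ B ∩ ∁ A                ≡⟨ cong (_∪ B ∩ ∁ A) (trans (sym A∩B≡⊥) (∩-comm A B)) ⟩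
  B ∩ A ∪ B ∩ ∁ A            ≡⟨ ∩-distribˡ-∪ B A (∁ A) ⟨
  B ∩ (A ∪ ∁ A)              ≡⟨ cong (B ∩_) (∪-inverseʳ A) ⟩
  B ∩ ⊤                      ≡⟨ ∩-identityʳ B ⟩
  B                          ∎
  where open ≡-Reasoning

∅J : PJA n Act
∅J = replicate _ nothing

restrict-⊥ : (σ : PJA n Act) → restrict σ ⊥ ≡ ∅J
restrict-⊥ []      = refl
restrict-⊥ (_ ∷ σ) = cong (nothing ∷_) (restrict-⊥ σ)

restrict-dom : (σ : PJA n Act) → restrict σ (dom σ) ≡ σ
restrict-dom []            = refl
restrict-dom (just x ∷ σ)  = cong (just x ∷_) (restrict-dom σ)
restrict-dom (nothing ∷ σ) = cong (nothing ∷_) (restrict-dom σ)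

restrict-restrict : (σ : PJA n Act) (C D : Subset n) → restrict (restrict σ C) D ≡ restrict σ (D ∩ C)
restrict-restrict []      []      []          = refl
restrict-restrict (x ∷ σ) (c ∷ C) (true ∷ D)  = cong (_ ∷_) (restrict-restrict σ C D)
restrict-restrict (x ∷ σ) (c ∷ C) (false ∷ D) = cong (nothing ∷_) (restrict-restrict σ C D)

restrict-∪J : (σ τ : PJA n Act) (C : Subset n) → restrict (σ ∪J τ) C ≡ restrict σ C ∪J restrict τ C
restrict-∪J []            []      []          = refl
restrict-∪J (just x ∷ σ)  (y ∷ τ) (true ∷ C)  = cong (just x ∷_) (restrict-∪J σ τ C)
restrict-∪J (nothing ∷ σ) (y ∷ τ) (true ∷ C)  = cong (y ∷_) (restrict-∪J σ τ C)
restrict-∪J (x ∷ σ)       (y ∷ τ) (false ∷ C) = cong (nothing ∷_) (restrict-∪J σ τ C)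

restrict-∪ : (σ : PJA n Act) (C D : Subset n) → restrict σ (C ∪ D) ≡ restrict σ C ∪J restrict σ D
restrict-∪ []            []          []          = refl
restrict-∪ (just x ∷ σ)  (true ∷ C)  (d ∷ D)     = cong (just x ∷_) (restrict-∪ σ C D)
restrict-∪ (nothing ∷ σ) (true ∷ C)  (true ∷ D)  = cong (nothing ∷_) (restrict-∪ σ C D)
restrict-∪ (nothing ∷ σ) (true ∷ C)  (false ∷ D) = cong (nothing ∷_) (restrict-∪ σ C D)
restrict-∪ (x ∷ σ)       (false ∷ C) (true ∷ D)  = cong (x ∷_) (restrict-∪ σ C D)
restrict-∪ (x ∷ σ)       (false ∷ C) (false ∷ D) = cong (nothing ∷_) (restrict-∪ σ C D)

∪J-identityʳ : (σ : PJA n Act) → σ ∪J ∅J ≡ σ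
∪J-identityʳ []            = refl
∪J-identityʳ (just x ∷ σ)  = cong (just x ∷_) (∪J-identityʳ σ)
∪J-identityʳ (nothing ∷ σ) = cong (nothing ∷_) (∪J-identityʳ σ)

dom-restrict : (σ : PJA n Act) (C : Subset n) → dom (restrict σ C) ≡ dom σ ∩ C
dom-restrict []            []          = refl
dom-restrict (just x ∷ σ)  (true ∷ C)  = cong (true ∷_) (dom-restrict σ C)
dom-restrict (nothing ∷ σ) (true ∷ C)  = cong (false ∷_) (dom-restrict σ C)
dom-restrict (just x ∷ σ)  (false ∷ C) = cong (false ∷_) (dom-restrict σ C)
dom-restrict (nothing ∷ σ) (false ∷ C) = cong (false ∷_) (dom-restrict σ C)

dom-∪J : (σ τ : PJA n Act) → dom (σ ∪J τ) ≡ dom σ ∪ dom τ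
dom-∪J []            []      = refl
dom-∪J (just x ∷ σ)  (y ∷ τ) = cong (true ∷_) (dom-∪J σ τ)
dom-∪J (nothing ∷ σ) (y ∷ τ) = cong (is-just y ∷_) (dom-∪J σ τ)

lookup-restrict-∈ : (σ : PJA n Act) → i ∈ C → lookup (restrict σ C) i ≡ lookup σ i
lookup-restrict-∈ (x ∷ σ) here      = refl
lookup-restrict-∈ (x ∷ σ) (there m) = lookup-restrict-∈ σ m

lookup-∪J-just : (σ τ : PJA n Act) {i : Fin n} → is-just (lookup σ i) ≡ true → lookup (σ ∪J τ) i ≡ lookup σ i
lookup-∪J-just (just x ∷ σ) (y ∷ τ) {zero}  _ = refl
lookup-∪J-just (x ∷ σ)      (y ∷ τ) {suc i} j = lookup-∪J-just σ τ j

lookup-∪J-nothing : (σ τ : PJA n Act) {i : Fin n} → lookup σ i ≡ nothing → lookup (σ ∪J τ) i ≡ lookup τ i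
lookup-∪J-nothing (nothing ∷ σ) (y ∷ τ) {zero}  _ = refl
lookup-∪J-nothing (x ∷ σ)       (y ∷ τ) {suc i} e = lookup-∪J-nothing σ τ e

restrict-⁅⁆-cong : (σ τ : PJA n Act) (a : Fin n) → lookup σ a ≡ lookup τ a → restrict σ ⁅ a ⁆ ≡ restrict τ ⁅ a ⁆
restrict-⁅⁆-cong (x ∷ σ) (y ∷ τ) zero    e = cong₂ _∷_ e (trans (restrict-⊥ σ) (sym (restrict-⊥ τ)))
restrict-⁅⁆-cong (x ∷ σ) (y ∷ τ) (suc a) e = cong (nothing ∷_) (restrict-⁅⁆-cong σ τ a e)

JA-∈ : {σ : PJA n Act} → IsJA C σ → i ∈ C → is-just (lookup σ i) ≡ true
JA-∈ {σ = σ} refl i∈C = trans (sym (lookup-map _ is-just σ)) ([]=⇒lookup i∈C)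

JA-∉ : (σ : PJA n Act) {i : Fin n} → IsJA C σ → i ∉ C → lookup σ i ≡ nothing
JA-∉ (nothing ∷ σ) {zero}  refl _   = refl
JA-∉ (just x ∷ σ)  {zero}  refl i∉C = ⊥-elim (i∉C here)
JA-∉ (x ∷ σ)       {suc i} refl i∉C = JA-∉ σ refl (i∉C ∘ there)

∉-there : ∀ {b} → i ∉ C → suc i ∉ b ∷ C
∉-there i∉C (there i∈C) = i∉C i∈C

JA-intro : (σ : PJA n Act) (C : Subset n) →
           (∀ {i} → i ∈ C → is-just (lookup σ i) ≡ true) → (∀ {i} → i ∉ C → lookup σ i ≡ nothing) → IsJA C σ
JA-intro []      []          _     _     = refl
JA-intro (x ∷ σ) (true ∷ C)  inside outside =
  cong₂ _∷_ (inside here) (JA-intro σ C (inside ∘ there) (outside ∘ ∉-there))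
JA-intro (x ∷ σ) (false ∷ C) inside outside =
  cong₂ _∷_ (cong is-just (outside {zero} λ ())) (JA-intro σ C (inside ∘ there) (outside ∘ ∉-there))

restrict-JA : {σ : PJA n Act} → IsJA C σ → ∀ D → restrict σ D ≡ restrict σ (D ∩ C)
restrict-JA {σ = σ} refl D = trans (cong (λ τ → restrict τ D) (sym (restrict-dom σ))) (restrict-restrict σ _ D)

restrict-JA-self : {σ : PJA n Act} → IsJA C σ → restrict σ C ≡ σ
restrict-JA-self {σ = σ} refl = restrict-dom σ

restrict-JA-⊇ : {σ : PJA n Act} → IsJA C σ → C ⊆ D → restrict σ D ≡ σ
restrict-JA-⊇ {D = D} {σ} σ-JA C⊆D =
  trans (restrict-JA σ-JA D) (trans (cong (restrict σ) (p⊆q⇒q∩p≡p C⊆D)) (restrict-JA-self σ-JA))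

restrict-JA-disjoint : {σ : PJA n Act} → IsJA C σ → D ∩ C ≡ ⊥ → restrict σ D ≡ ∅J
restrict-JA-disjoint {D = D} {σ} σ-JA D∩C≡⊥ =
  trans (restrict-JA σ-JA D) (trans (cong (restrict σ) D∩C≡⊥) (restrict-⊥ σ))

restrict-∪J-∁ : {σ ρ : PJA n Act} → IsJA C σ → IsJA (∁ C) ρ → restrict (σ ∪J ρ) C ≡ σ
restrict-∪J-∁ {C = C} {σ} {ρ} σ-JA ρ-JA = begin
  restrict (σ ∪J ρ) C            ≡⟨ restrict-∪J σ ρ C ⟩
  restrict σ C ∪J restrict ρ C   ≡⟨ cong₂ _∪J_ (restrict-JA-self σ-JA) (restrict-JA-disjoint ρ-JA (∩-inverseʳ C)) ⟩
  σ ∪J ∅J                        ≡⟨ ∪J-identityʳ σ ⟩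
  σ                              ∎
  where open ≡-Reasoning

module _ (A : Subset n) (f : (a : Fin n) → a ∈ A → PJA n Act) where

  lookup-bigUnion-∈ : (i∈A : i ∈ A) → lookup (bigUnion A f) i ≡ lookup (f i i∈A) i
  lookup-bigUnion-∈ {i = i} i∈A rewrite (lookup (bigUnion A f) i ≡ _ ∋ lookup∘tabulate _ i) with i ∈? A
  ... | yes i∈A′ = cong (λ i∈A″ → lookup (f i i∈A″) i) ([]=-irrelevant i∈A′ i∈A)
  ... | no  i∉A  = ⊥-elim (i∉A i∈A)

  lookup-bigUnion-∉ : i ∉ A → lookup (bigUnion A f) i ≡ nothing
  lookup-bigUnion-∉ {i = i} i∉A rewrite (lookup (bigUnion A f) i ≡ _ ∋ lookup∘tabulate _ i) with i ∈? A
  ... | yes i∈A = ⊥-elim (i∉A i∈A)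
  ... | no  _   = refl

  dom-bigUnion : (∀ a a∈A → IsJA ⁅ a ⁆ (f a a∈A)) → IsJA A (bigUnion A f)
  dom-bigUnion f-JA = JA-intro (bigUnion A f) A
    (λ {i} i∈A → trans (cong is-just (lookup-bigUnion-∈ i∈A)) (JA-∈ (f-JA i i∈A) (x∈⁅x⁆ i)))
    lookup-bigUnion-∉

  restrict-bigUnion : ∀ {a} (a∈A : a ∈ A) → IsJA ⁅ a ⁆ (f a a∈A) → restrict (bigUnion A f) ⁅ a ⁆ ≡ f a a∈A
  restrict-bigUnion {a} a∈A fa-JA =
    trans (restrict-⁅⁆-cong _ _ a (lookup-bigUnion-∈ a∈A)) (restrict-JA-self fa-JA)

bigUnion-restrict : (σ : PJA n Act) → IsJA A σ → bigUnion A (λ a _ → restrict σ ⁅ a ⁆) ≡ σ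
bigUnion-restrict {A = A} σ σ-JA = Pointwise-≡⇒≡ (ext pointwise)
  where
  pointwise : ∀ i → lookup (bigUnion A (λ a _ → restrict σ ⁅ a ⁆)) i ≡ lookup σ i
  pointwise i with i ∈? A
  ... | yes i∈A = trans (lookup-bigUnion-∈ A _ i∈A) (lookup-restrict-∈ σ (x∈⁅x⁆ i))
  ... | no  i∉A = trans (lookup-bigUnion-∉ A _ i∉A) (sym (JA-∉ σ σ-JA i∉A))

module _ {AP : Set} (M : Model n AP) where
  open Model M

  AgentwiseAvailable : Subset n → ST → PJA n AC → Set
  AgentwiseAvailable A s σ = IsJA A σ × (∀ a → a ∈ A → av ⁅ a ⁆ s (restrict σ ⁅ a ⁆))

  ⊕av⇔agentwise : ∀ A s σ → ⊕av M A s σ ⇔ AgentwiseAvailable A s σ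
  ⊕av⇔agentwise A s σ = mk⇔ to from
    where
    to : ⊕av M A s σ → AgentwiseAvailable A s σ
    to (f , f-av , refl) = dom-bigUnion A f f-JA , λ a a∈A →
      subst (av ⁅ a ⁆ s) (sym (restrict-bigUnion A f a∈A (f-JA a a∈A))) (f-av a a∈A)
      where
      f-JA : ∀ a a∈A → IsJA ⁅ a ⁆ (f a a∈A)
      f-JA a a∈A = av-JA _ _ _ (f-av a a∈A)
    from : AgentwiseAvailable A s σ → ⊕av M A s σ
    from (σ-JA , agents) = (λ a _ → restrict σ ⁅ a ⁆) , agents , sym (bigUnion-restrict σ σ-JA)

  agentwise-restrict : ∀ {A B s σ} → B ⊆ A → AgentwiseAvailable A s σ → AgentwiseAvailable B s (restrict σ B)
  agentwise-restrict {A} {B} {s} {σ} B⊆A (refl , agents) =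
    trans (dom-restrict σ B) (p⊆q⇒q∩p≡p B⊆A) , λ a a∈B →
      subst (av ⁅ a ⁆ s) (restrict-⁅⁆-cong σ _ a (sym (lookup-restrict-∈ σ a∈B))) (agents a (B⊆A a∈B))

  agentwise-∪J : ∀ {A B s σ τ} → AgentwiseAvailable A s σ → AgentwiseAvailable B s τ →
                 AgentwiseAvailable (A ∪ B) s (σ ∪J τ)
  agentwise-∪J {A} {B} {s} {σ} {τ} (σ-JA , σ-agents) (τ-JA , τ-agents) =
    trans (dom-∪J σ τ) (cong₂ _∪_ σ-JA τ-JA) , agents
    where
    agents : ∀ a → a ∈ A ∪ B → av ⁅ a ⁆ s (restrict (σ ∪J τ) ⁅ a ⁆)
    agents a a∈A∪B with a ∈? A | x∈p∪q⁻ A B a∈A∪B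
    ... | yes a∈A | _ = subst (av ⁅ a ⁆ s)
            (restrict-⁅⁆-cong σ _ a (sym (lookup-∪J-just σ τ (JA-∈ σ-JA a∈A)))) (σ-agents a a∈A)
    ... | no a∉A | inj₁ a∈A = ⊥-elim (a∉A a∈A)
    ... | no a∉A | inj₂ a∈B = subst (av ⁅ a ⁆ s)
            (restrict-⁅⁆-cong τ _ a (sym (lookup-∪J-nothing σ τ (JA-∉ σ σ-JA a∉A)))) (τ-agents a a∈B)

  Cond2⇒av-restrict : Cond2 M → ∀ {s} σ C → (∀ a → a ∈ C → av ⁅ a ⁆ s (restrict σ ⁅ a ⁆)) → av C s (restrict σ C)
  Cond2⇒av-restrict c2 {s} σ C = go C (⊂-wellFounded C)
    where
    av-restricted : Subset n → Set
    av-restricted D = av D s (restrict σ D)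

    empty : av-restricted ⊥
    empty with proj₁ (c2 ⊥ ⊥ (∩-zeroʳ ⊥) s)
    ... | ρ , ρ-av = subst (av ⊥ s) ρ≡σ|⊥ ρ-av
      where
      ρ≡σ|⊥ : ρ ≡ restrict σ ⊥
      ρ≡σ|⊥ = trans (sym (restrict-JA-self (av-JA _ _ _ ρ-av))) (trans (restrict-⊥ ρ) (sym (restrict-⊥ σ)))

    go : ∀ C → Acc _⊂_ C → (∀ a → a ∈ C → av-restricted ⁅ a ⁆) → av-restricted C
    go C (acc smaller) agents with nonempty? C
    ... | no C-empty    = subst av-restricted (sym (Empty-unique C-empty)) empty
    ... | yes (a , a∈C) = subst av-restricted (p⊆q⇒p∪[q─p]≡q (x∈p⇒⁅x⁆⊆p a∈C))
                            (subst (av _ s) (sym (restrict-∪ σ ⁅ a ⁆ (C - a))) a∪rest)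
      where
      rest : av-restricted (C - a)
      rest = go (C - a) (smaller (x∈p⇒p-x⊂p a∈C)) (λ b b∈C-a → agents b (p─q⊆p C ⁅ a ⁆ b∈C-a))
      a∪rest : av (⁅ a ⁆ ∪ (C - a)) s (restrict σ ⁅ a ⁆ ∪J restrict σ (C - a))
      a∪rest = proj₂ (proj₂ (c2 ⁅ a ⁆ (C - a) (p∩[q─p]≡⊥ ⁅ a ⁆ C) s)) _ _ (agents a a∈C) rest

  Cond2⇒av⇔agentwise : Cond2 M → ∀ A s σ → av A s σ ⇔ AgentwiseAvailable A s σ
  Cond2⇒av⇔agentwise c2 A s σ = mk⇔ to from
    where
    to : av A s σ → AgentwiseAvailable A s σ
    to σ-av = av-JA _ _ _ σ-av , λ a a∈A →
      proj₁ (proj₂ (c2 ⁅ a ⁆ (A - a) (p∩[q─p]≡⊥ ⁅ a ⁆ A) s)) σ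
        (subst (λ C → av C s σ) (sym (p⊆q⇒p∪[q─p]≡q (x∈p⇒⁅x⁆⊆p a∈A))) σ-av)
    from : AgentwiseAvailable A s σ → av A s σ
    from (σ-JA , agents) = subst (av A s) (restrict-JA-self σ-JA) (Cond2⇒av-restrict c2 σ A agents)

  Cond2⇒Cond1 : Cond2 M → Cond1 M
  Cond2⇒Cond1 c2 a A s = proj₁ (c2 ⁅ a ⁆ ⊥ (∩-zeroʳ ⁅ a ⁆) s) , λ σ → to (av⇔⊕av σ) , from (av⇔⊕av σ)
    where
    open Equivalence
    av⇔⊕av : ∀ σ → av A s σ ⇔ ⊕av M A s σ
    av⇔⊕av σ = ⇔-sym (⊕av⇔agentwise A s σ) ⇔-∘ Cond2⇒av⇔agentwise c2 A s σ

  Cond2⇒Cond3 : Cond2 M → Cond3 M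
  Cond2⇒Cond3 c2 A s with c2 A (∁ A) (∩-inverseʳ A) s
  ... | nonempty , restrict-closed , union-closed =
    nonempty ,
    (λ σ σ-av → restrict-closed σ (subst (λ C → av C s σ) (sym (∪-inverseʳ A)) σ-av)) ,
    (λ σ τ σ-av τ-av → subst (λ C → av C s (σ ∪J τ)) (∪-inverseʳ A) (union-closed σ τ σ-av τ-av))

  Cond3⇒extension : Cond3 M → ∀ {C s σ} → av C s σ → ∃ λ τ → av ⊤ s τ × restrict τ C ≡ σ
  Cond3⇒extension c3 {C} {s} {σ} σ-av with proj₁ (c3 (∁ C) s)
  ... | ρ , ρ-av = σ ∪J ρ , proj₂ (proj₂ (c3 C s)) σ ρ σ-av ρ-av , restrict-∪J-∁ (av-JA _ _ _ σ-av) (av-JA _ _ _ ρ-av)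

  Cond3⇒Cond2 : Cond3 M → Cond2 M
  Cond3⇒Cond2 c3 A B A∩B≡⊥ s = proj₁ (c3 A s) , restrict-closed , union-closed
    where
    restrict-from-⊤ : ∀ C τ → av ⊤ s τ → av C s (restrict τ C)
    restrict-from-⊤ C = proj₁ (proj₂ (c3 C s))

    restrict-closed : ∀ σ → av (A ∪ B) s σ → av A s (restrict σ A)
    restrict-closed σ σ-av with Cond3⇒extension c3 σ-av
    ... | τ , τ-av , refl = subst (av A s) τ|A≡τ|A∪B|A (restrict-from-⊤ A τ τ-av)
      where
      τ|A≡τ|A∪B|A : restrict τ A ≡ restrict (restrict τ (A ∪ B)) A
      τ|A≡τ|A∪B|A = trans (cong (restrict τ) (sym (∩-abs-∪ A B))) (sym (restrict-restrict τ (A ∪ B) A))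

    union-closed : ∀ σA σB → av A s σA → av B s σB → av (A ∪ B) s (σA ∪J σB)
    union-closed σA σB σA-av σB-av with Cond3⇒extension c3 σB-av
    ... | τ , τ-av , refl = subst (av (A ∪ B) s) restricts-to-σA∪σB (restrict-from-⊤ (A ∪ B) _ full)
      where
      full : av ⊤ s (σA ∪J restrict τ (∁ A))
      full = proj₂ (proj₂ (c3 A s)) σA _ σA-av (restrict-from-⊤ (∁ A) τ τ-av)
      open ≡-Reasoning
      restricts-to-σA∪σB : restrict (σA ∪J restrict τ (∁ A)) (A ∪ B) ≡ σA ∪J restrict τ B
      restricts-to-σA∪σB = begin
        restrict (σA ∪J restrict τ (∁ A)) (A ∪ B)
          ≡⟨ restrict-∪J σA _ (A ∪ B) ⟩
        restrict σA (A ∪ B) ∪J restrict (restrict τ (∁ A)) (A ∪ B)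
          ≡⟨ cong₂ _∪J_ (restrict-JA-⊇ (av-JA _ _ _ σA-av) (p⊆p∪q B)) (restrict-restrict τ (∁ A) (A ∪ B)) ⟩
        σA ∪J restrict τ ((A ∪ B) ∩ ∁ A)
          ≡⟨ cong (λ C → σA ∪J restrict τ C) (p∩q≡⊥⇒[p∪q]∩∁p≡q A∩B≡⊥) ⟩
        σA ∪J restrict τ B
          ∎

module _ {k : ℕ} {AP : Set} (M : Model (suc k) AP) where
  open Model M

  Cond1⇒av⇔agentwise : Cond1 M → ∀ A s σ → av A s σ ⇔ AgentwiseAvailable M A s σ
  -- Clause (b) of Cond1 sits under the quantifier over agents, so reading it off needs some agent.
  Cond1⇒av⇔agentwise c1 A s σ = ⊕av⇔agentwise M A s σ ⇔-∘ mk⇔ (proj₁ (av⇔⊕av σ)) (proj₂ (av⇔⊕av σ))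
    where
    av⇔⊕av : ∀ σ → (av A s σ → ⊕av M A s σ) × (⊕av M A s σ → av A s σ)
    av⇔⊕av = proj₂ (c1 zero A s)

  Cond1⇒Cond2 : Cond1 M → Cond2 M
  Cond1⇒Cond2 c1 A B _ s = nonempty , restrict-closed , union-closed
    where
    open Equivalence
    av⇔agentwise : ∀ A s σ → av A s σ ⇔ AgentwiseAvailable M A s σ
    av⇔agentwise = Cond1⇒av⇔agentwise c1
    nonempty : ∃ λ σ → av A s σ
    nonempty = bigUnion A choice , proj₂ (proj₂ (c1 zero A s) _) (choice , choice-av , refl)
      where
      choice : (a : Fin (suc k)) → a ∈ A → PJA (suc k) AC
      choice a _ = proj₁ (proj₁ (c1 a A s))
      choice-av : ∀ a a∈A → av ⁅ a ⁆ s (choice a a∈A)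
      choice-av a _ = proj₂ (proj₁ (c1 a A s))
    restrict-closed : ∀ σ → av (A ∪ B) s σ → av A s (restrict σ A)
    restrict-closed σ σ-av = from (av⇔agentwise A s _) (agentwise-restrict M (p⊆p∪q B) (to (av⇔agentwise (A ∪ B) s σ) σ-av))
    union-closed : ∀ σA σB → av A s σA → av B s σB → av (A ∪ B) s (σA ∪J σB)
    union-closed σA σB σA-av σB-av =
      from (av⇔agentwise (A ∪ B) s _) (agentwise-∪J M (to (av⇔agentwise A s σA) σA-av) (to (av⇔agentwise B s σB) σB-av))

mainTheorem7 : ∀ {k : ℕ} {AP : Set} → Countable AP → (M : Model (suc k) AP) →
    (Cond1 M ⇔ Cond2 M) × (Cond2 M ⇔ Cond3 M)
mainTheorem7 _ M = mk⇔ (Cond1⇒Cond2 M) (Cond2⇒Cond1 M) , mk⇔ (Cond2⇒Cond3 M) (Cond3⇒Cond2 M)
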